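{- For every integer $s \geq 0$, there exist $2^s$ edge-disjoint maximal outerplanar graphs on $4 \cdot 2^s$ vertices, each with maximum degree $2s+3$.
   Context: A graph is outerplanar if it admits a crossing-free drawing in the plane with all vertices on the outer face. An outerplanar graph is maximal if no edge can be added to it without destroying outerplanarity. "$t$ edge-disjoint outerplanar graphs on $n$ vertices" means $t$ outerplanar graphs on the same vertex set $V$ with $|V| = n$ whose edge sets are pairwise disjoint. -}

module Defs where

open import Data.Nat using (ℕ; zero; suc; _+_; _≤_)
open import Data.Bool using (Bool; true; false; if_then_else_)
open import Data.Fin using (Fin; zero; suc; _<_)
open import Data.Fin.Permutation using (Permutation′; _⟨$⟩ʳ_)
open import Data.Product using (_×_; ∃)
open import Data.Sum using (_⊎_)
open import Function.Bundles using (_⇔_)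
open import Relation.Nullary using (¬_)
open import Relation.Binary.PropositionalEquality using (_≡_; _≢_)

record Graph (n : ℕ) : Set where
  field
    adj    : Fin n → Fin n → Bool
    sym    : ∀ u v → adj u v ≡ adj v u
    irrefl : ∀ v → adj v v ≡ false
open Graph public

-- Outerplanar: the vertices can be placed in a cyclic order (on a circle,
-- i.e. on the outer face) so that no two edges cross.
Outerplanar : ∀ {n} → Graph n → Set
Outerplanar {n} G =
  ∃ λ (π : Permutation′ n) →
    ∀ a b c d → adj G a b ≡ true → adj G c d ≡ true →
      ¬ ((π ⟨$⟩ʳ a < π ⟨$⟩ʳ c) × (π ⟨$⟩ʳ c < π ⟨$⟩ʳ b) × (π ⟨$⟩ʳ b < π ⟨$⟩ʳ d))

IsAddEdge : ∀ {n} → Graph n → Fin n → Fin n → Graph n → Set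
IsAddEdge G u v H =
  ∀ x y → (adj H x y ≡ true) ⇔
            (adj G x y ≡ true ⊎ ((x ≡ u × y ≡ v) ⊎ (x ≡ v × y ≡ u)))

MaximalOuterplanar : ∀ {n} → Graph n → Set
MaximalOuterplanar {n} G =
  Outerplanar G ×
  (∀ u v → u ≢ v → adj G u v ≡ false →
     ∀ (H : Graph n) → IsAddEdge G u v H → ¬ Outerplanar H)

countTrue : ∀ {n} → (Fin n → Bool) → ℕ
countTrue {zero}  f = 0
countTrue {suc n} f = (if f zero then 1 else 0) + countTrue (λ i → f (suc i))

degree : ∀ {n} → Graph n → Fin n → ℕ
degree G v = countTrue (adj G v)

MaxDegree : ∀ {n} → Graph n → ℕ → Set
MaxDegree G Δ = (∀ v → degree G v ≤ Δ) × ∃ (λ v → degree G v ≡ Δ)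

EdgeDisjoint : ∀ {k n} → (Fin k → Graph n) → Set
EdgeDisjoint {k} {n} Gs =
  ∀ (i j : Fin k) → i ≢ j → ∀ (u v : Fin n) →
    adj (Gs i) u v ≡ true → adj (Gs j) u v ≡ false

{-# OPTIONS --safe #-}

-- Let N = 4 · 2 ^ s. Doubling the single edge {0, 1} s + 1 times (each time put a copy of the current
-- graph on the even vertices and add the boundary cycle through all vertices) gives a triangulation T
-- of the N-gon: an outerplanar graph with 2N − 3 edges, hence maximal, and of maximum degree 2s + 3,
-- attained at 0. For a < 2 ^ s the a-th graph is T relabelled by the affine bijection x ↦ a + h x of
-- ℤ/N with the odd multiplier h = 1 + 4 · rev(a), rev reversing the s binary digits of a. Two of these
-- images share no edge, by induction on s: a boundary-cycle edge of the image for a has endpoints that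
-- differ by ± h, which is odd and determines a; an edge of the copy has both endpoints of the parity
-- of a, and halving them gives an edge of the image for ⌊a/2⌋ one level down.
module Submission where

open import Data.Bool using (Bool; true; false; _∨_; _∧_; if_then_else_)
open import Data.Empty using (⊥; ⊥-elim)
open import Data.Fin as Fin using (Fin; zero; suc; toℕ)
open import Data.Fin.Permutation
  using (Permutation′; _⟨$⟩ʳ_; _⟨$⟩ˡ_; inverseˡ; inverseʳ; flip; permutation)
open import Data.Fin.Properties as Fin using ()
open import Data.Nat using (ℕ; zero; suc; _+_; _*_; _^_; _∸_; _≤_; _<_; z≤n; s≤s; NonZero; _≟_; _%_; _/_)
open import Data.Nat.Divisibility using (_∣_; divides)
open import Data.Nat.DivMod using (m≡m%n+[m/n]*n; [m+kn]%n≡m%n; m<n⇒m%n≡m; m%n<n; m<n*o⇒m/o<n)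
open import Data.Nat.Properties
open import Data.Nat.Tactic.RingSolver using (solve-∀)
open import Data.Product using (_×_; _,_; ∃; ∃₂; proj₁; proj₂)
open import Data.Sum using (_⊎_; inj₁; inj₂; [_,_]′)
open import Function using (_∘_; _⇔_; Equivalence; mk⇔)
open import Level using (0ℓ)
open import Relation.Binary.Bundles using (Setoid)
open import Relation.Binary.Definitions using (tri<; tri≈; tri>)
open import Relation.Binary.PropositionalEquality
import Relation.Binary.Reasoning.Setoid as SetoidReasoning
open import Relation.Nullary using (¬_; Dec; yes; no; does; contradiction; map′)
open import Relation.Nullary.Decidable using (dec-true; dec-false; does-⇔; _⊎-dec_; _×-dec_)

open import Defs hiding (sym)
open import Algebra.Properties.CommutativeMonoid.Sum +-0-commutativeMonoid
  using (sum; sum-permute; ∑-distrib-+; sum-cong-≗)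

-- Counting

∨-true⇒ : ∀ {x y} → x ∨ y ≡ true → x ≡ true ⊎ y ≡ true
∨-true⇒ {true}  _ = inj₁ refl
∨-true⇒ {false} y = inj₂ y

∧-true⇒ : ∀ {x y} → x ∧ y ≡ true → x ≡ true × y ≡ true
∧-true⇒ {true} y = refl , y

does⇒ : ∀ {A : Set} (A? : Dec A) → does A? ≡ true → A
does⇒ (yes a) _ = a

does-exclusive : ∀ {A B : Set} (A? : Dec A) (B? : Dec B) → (A → ¬ B) → does A? ∧ does B? ≡ false
does-exclusive (yes a) B? A⇒¬B = dec-false B? (A⇒¬B a)
does-exclusive (no _)  _  _    = refl

iverson : Bool → ℕ
iverson b = if b then 1 else 0

iverson-∨-∧ : ∀ x y → iverson (x ∨ y) + iverson (x ∧ y) ≡ iverson x + iverson y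
iverson-∨-∧ true  true  = refl
iverson-∨-∧ true  false = refl
iverson-∨-∧ false y     = +-identityʳ (iverson y)

iverson≤1 : ∀ x → iverson x ≤ 1
iverson≤1 true  = s≤s z≤n
iverson≤1 false = z≤n

countTrue≡sum : ∀ {n} (f : Fin n → Bool) → countTrue f ≡ sum (iverson ∘ f)
countTrue≡sum {zero}  f = refl
countTrue≡sum {suc n} f = cong (iverson (f zero) +_) (countTrue≡sum (f ∘ suc))

countTrue-cong : ∀ {n} {f g : Fin n → Bool} → (∀ i → f i ≡ g i) → countTrue f ≡ countTrue g
countTrue-cong {zero}  _   = refl
countTrue-cong {suc n} f≗g = cong₂ _+_ (cong iverson (f≗g zero)) (countTrue-cong (f≗g ∘ suc))

countTrue-false : ∀ {n} {f : Fin n → Bool} → (∀ i → f i ≡ false) → countTrue f ≡ 0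
countTrue-false {zero}  _       = refl
countTrue-false {suc n} f≡false rewrite f≡false zero = countTrue-false (f≡false ∘ suc)

countTrue-permute : ∀ {n} (f : Fin n → Bool) (π : Permutation′ n) → countTrue f ≡ countTrue (f ∘ (π ⟨$⟩ʳ_))
countTrue-permute f π = begin
  countTrue f                    ≡⟨ countTrue≡sum f ⟩
  sum (iverson ∘ f)              ≡⟨ sum-permute (iverson ∘ f) π ⟩
  sum (iverson ∘ f ∘ (π ⟨$⟩ʳ_))  ≡⟨ countTrue≡sum (f ∘ (π ⟨$⟩ʳ_)) ⟨
  countTrue (f ∘ (π ⟨$⟩ʳ_))      ∎
  where open ≡-Reasoning

countTrue-∨-∧ : ∀ {n} (f g : Fin n → Bool) →
                countTrue (λ i → f i ∨ g i) + countTrue (λ i → f i ∧ g i) ≡ countTrue f + countTrue g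
countTrue-∨-∧ f g = begin
  countTrue (λ i → f i ∨ g i) + countTrue (λ i → f i ∧ g i)
    ≡⟨ cong₂ _+_ (countTrue≡sum (λ i → f i ∨ g i)) (countTrue≡sum (λ i → f i ∧ g i)) ⟩
  sum (λ i → iverson (f i ∨ g i)) + sum (λ i → iverson (f i ∧ g i))
    ≡⟨ ∑-distrib-+ (λ i → iverson (f i ∨ g i)) (λ i → iverson (f i ∧ g i)) ⟨
  sum (λ i → iverson (f i ∨ g i) + iverson (f i ∧ g i))
    ≡⟨ sum-cong-≗ (λ i → iverson-∨-∧ (f i) (g i)) ⟩
  sum (λ i → iverson (f i) + iverson (g i))
    ≡⟨ ∑-distrib-+ (iverson ∘ f) (iverson ∘ g) ⟩
  sum (iverson ∘ f) + sum (iverson ∘ g)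
    ≡⟨ cong₂ _+_ (countTrue≡sum f) (countTrue≡sum g) ⟨
  countTrue f + countTrue g
    ∎
  where open ≡-Reasoning

countTrue-disjoint-∨ : ∀ {n} (f g : Fin n → Bool) → (∀ i → f i ∧ g i ≡ false) →
                       countTrue (λ i → f i ∨ g i) ≡ countTrue f + countTrue g
countTrue-disjoint-∨ f g disjoint = begin
  countTrue (λ i → f i ∨ g i)                                ≡⟨ +-identityʳ _ ⟨
  countTrue (λ i → f i ∨ g i) + 0                            ≡⟨ cong (countTrue (λ i → f i ∨ g i) +_)
                                                                     (countTrue-false disjoint) ⟨
  countTrue (λ i → f i ∨ g i) + countTrue (λ i → f i ∧ g i)  ≡⟨ countTrue-∨-∧ f g ⟩
  countTrue f + countTrue g                                  ∎
  where open ≡-Reasoning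

countTrue-insert : ∀ {n} {f g : Fin n → Bool} (a : Fin n) → f a ≡ false → g a ≡ true →
                   (∀ i → i ≢ a → g i ≡ f i) → countTrue g ≡ suc (countTrue f)
countTrue-insert zero fa ga g≗f rewrite fa | ga =
  cong suc (countTrue-cong (λ i → g≗f (suc i) λ ()))
countTrue-insert {f = f} (suc a) fa ga g≗f rewrite g≗f zero (λ ()) =
  trans (cong (iverson (f zero) +_) (countTrue-insert a fa ga (λ i i≢a → g≗f (suc i) (i≢a ∘ Fin.suc-injective))))
        (+-suc _ _)

countTrue-≟ : ∀ {n} (u : Fin n) → countTrue (λ x → does (x Fin.≟ u)) ≡ 1
countTrue-≟ {n} u = trans
  (countTrue-insert {f = λ _ → false} u refl (dec-true (u Fin.≟ u) refl) (λ x x≢u → dec-false (x Fin.≟ u) x≢u))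
  (cong suc (countTrue-false {n} (λ _ → refl)))

countTrue-≤1 : ∀ {n} (f : Fin n → Bool) → (∀ i j → f i ≡ true → f j ≡ true → i ≡ j) → countTrue f ≤ 1
countTrue-≤1 {zero}  _ _      = z≤n
countTrue-≤1 {suc n} f unique with f zero in f0
... | true  = ≤-reflexive (cong suc (countTrue-false rest-false))
  where
  rest-false : ∀ i → f (suc i) ≡ false
  rest-false i with f (suc i) in fi
  ... | false = refl
  ... | true  with () ← unique zero (suc i) f0 fi
... | false = countTrue-≤1 (f ∘ suc) (λ i j fi fj → Fin.suc-injective (unique (suc i) (suc j) fi fj))

-- Outerplanar graphs have at most 2n − 3 edges

degreeSum : ∀ {n} → Graph n → ℕ
degreeSum G = sum (degree G)

NonCrossing : ∀ {n} → (Fin n → Fin n → Bool) → Set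
NonCrossing R = ∀ a b c d → R a b ≡ true → R c d ≡ true → ¬ (a Fin.< c × c Fin.< b × b Fin.< d)

relabel : ∀ {n} → Permutation′ n → Graph n → Graph n
relabel σ G = record
  { adj    = λ u v → adj G (σ ⟨$⟩ʳ u) (σ ⟨$⟩ʳ v)
  ; sym    = λ u v → Graph.sym G (σ ⟨$⟩ʳ u) (σ ⟨$⟩ʳ v)
  ; irrefl = λ v → irrefl G (σ ⟨$⟩ʳ v)
  }

degree-relabel : ∀ {n} (σ : Permutation′ n) (G : Graph n) u → degree (relabel σ G) u ≡ degree G (σ ⟨$⟩ʳ u)
degree-relabel σ G u = sym (countTrue-permute (adj G (σ ⟨$⟩ʳ u)) σ)

degreeSum-relabel : ∀ {n} (σ : Permutation′ n) (G : Graph n) → degreeSum (relabel σ G) ≡ degreeSum G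
degreeSum-relabel σ G = trans (sum-cong-≗ (degree-relabel σ G)) (sym (sum-permute (degree G) σ))

relabel-outerplanar : ∀ {n} (σ : Permutation′ n) (G : Graph n) → NonCrossing (adj G) → Outerplanar (relabel σ G)
relabel-outerplanar σ G nonCrossing = σ , λ a b c d → nonCrossing (σ ⟨$⟩ʳ a) (σ ⟨$⟩ʳ b) (σ ⟨$⟩ʳ c) (σ ⟨$⟩ʳ d)

outerplanar⇒nonCrossing : ∀ {n} (G : Graph n) ((π , _) : Outerplanar G) → NonCrossing (adj (relabel (flip π) G))
outerplanar⇒nonCrossing G (π , nonCrossing) a b c d ab cd order =
  nonCrossing (π ⟨$⟩ˡ a) (π ⟨$⟩ˡ b) (π ⟨$⟩ˡ c) (π ⟨$⟩ˡ d) ab cd (positions order)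
  where
  positions : a Fin.< c × c Fin.< b × b Fin.< d →
              let p = λ i → π ⟨$⟩ʳ (π ⟨$⟩ˡ i) in p a Fin.< p c × p c Fin.< p b × p b Fin.< p d
  positions rewrite inverseʳ π {a} | inverseʳ π {b} | inverseʳ π {c} | inverseʳ π {d} = λ order → order

contract : ∀ {n} → Graph (2 + n) → Graph (1 + n)
contract {n} G = record { adj = merged ; sym = merged-sym ; irrefl = merged-irrefl }
  where
  merged : Fin (1 + n) → Fin (1 + n) → Bool
  merged zero    zero    = false
  merged zero    (suc b) = adj G zero (suc (suc b)) ∨ adj G (suc zero) (suc (suc b))
  merged (suc a) zero    = adj G (suc (suc a)) zero ∨ adj G (suc (suc a)) (suc zero)
  merged (suc a) (suc b) = adj G (suc (suc a)) (suc (suc b))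

  merged-sym : ∀ a b → merged a b ≡ merged b a
  merged-sym zero    zero    = refl
  merged-sym zero    (suc b) = cong₂ _∨_ (Graph.sym G _ _) (Graph.sym G _ _)
  merged-sym (suc a) zero    = cong₂ _∨_ (Graph.sym G _ _) (Graph.sym G _ _)
  merged-sym (suc a) (suc b) = Graph.sym G _ _

  merged-irrefl : ∀ a → merged a a ≡ false
  merged-irrefl zero    = refl
  merged-irrefl (suc a) = irrefl G (suc (suc a))

contract-nonCrossing : ∀ {n} (G : Graph (2 + n)) → NonCrossing (adj G) → NonCrossing (adj (contract G))
contract-nonCrossing G nonCrossing zero (suc b) (suc c) (suc d) ab cd (_ , s≤s c<b , s≤s b<d)
  with ∨-true⇒ ab
... | inj₁ 0b = nonCrossing zero (suc (suc b)) (suc (suc c)) (suc (suc d)) 0b cd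
                  (s≤s z≤n , s≤s (s≤s c<b) , s≤s (s≤s b<d))
... | inj₂ 1b = nonCrossing (suc zero) (suc (suc b)) (suc (suc c)) (suc (suc d)) 1b cd
                  (s≤s (s≤s z≤n) , s≤s (s≤s c<b) , s≤s (s≤s b<d))
contract-nonCrossing G nonCrossing (suc a) (suc b) (suc c) (suc d) ab cd (s≤s a<c , s≤s c<b , s≤s b<d) =
  nonCrossing (suc (suc a)) (suc (suc b)) (suc (suc c)) (suc (suc d)) ab cd
    (s≤s (s≤s a<c) , s≤s (s≤s c<b) , s≤s (s≤s b<d))
contract-nonCrossing _ _ _ zero _    _    _ _ (_ , () , _)
contract-nonCrossing _ _ _ _    zero _    _ _ (() , _)
contract-nonCrossing _ _ _ _    _    zero _ _ (_ , _ , ())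

adjacentToBoth : ∀ {n} → Graph (2 + n) → Fin n → Bool
adjacentToBoth G b = adj G zero (suc (suc b)) ∧ adj G (suc zero) (suc (suc b))

commonNeighbours : ∀ {n} → Graph (2 + n) → ℕ
commonNeighbours G = countTrue (adjacentToBoth G)

-- Two common neighbours i < j of the vertices 0 < 1 would give the crossing pair {0, i}, {1, j}.
commonNeighbours≤1 : ∀ {n} (G : Graph (2 + n)) → NonCrossing (adj G) → commonNeighbours G ≤ 1
commonNeighbours≤1 G nonCrossing = countTrue-≤1 (adjacentToBoth G) unique
  where
  unique : ∀ i j → adjacentToBoth G i ≡ true → adjacentToBoth G j ≡ true → i ≡ j
  unique i j common-i common-j with Fin.<-cmp i j
  ... | tri≈ _ i≡j _ = i≡j
  ... | tri< i<j _ _ = ⊥-elim (nonCrossing zero (suc (suc i)) (suc zero) (suc (suc j))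
          (proj₁ (∧-true⇒ common-i)) (proj₂ (∧-true⇒ common-j)) (s≤s z≤n , s≤s (s≤s z≤n) , s≤s (s≤s i<j)))
  ... | tri> _ _ j<i = ⊥-elim (nonCrossing zero (suc (suc j)) (suc zero) (suc (suc i))
          (proj₁ (∧-true⇒ common-j)) (proj₂ (∧-true⇒ common-i)) (s≤s z≤n , s≤s (s≤s z≤n) , s≤s (s≤s j<i)))

degree-contract : ∀ {n} (G : Graph (2 + n)) a →
  degree G (suc (suc a)) ≡
  degree (contract G) (suc a) + iverson (adj G (suc (suc a)) zero ∧ adj G (suc (suc a)) (suc zero))
degree-contract G a = begin
  iverson x + (iverson y + Z)               ≡⟨ +-assoc (iverson x) (iverson y) Z ⟨
  (iverson x + iverson y) + Z               ≡⟨ cong (_+ Z) (iverson-∨-∧ x y) ⟨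
  (iverson (x ∨ y) + iverson (x ∧ y)) + Z   ≡⟨ swap (iverson (x ∨ y)) (iverson (x ∧ y)) Z ⟩
  (iverson (x ∨ y) + Z) + iverson (x ∧ y)   ∎
  where
  open ≡-Reasoning
  x = adj G (suc (suc a)) zero
  y = adj G (suc (suc a)) (suc zero)
  Z = countTrue (λ b → adj G (suc (suc a)) (suc (suc b)))
  swap : ∀ x y z → (x + y) + z ≡ (x + z) + y
  swap = solve-∀

sum-degree-contract : ∀ {n} (G : Graph (2 + n)) →
  sum (λ a → degree G (suc (suc a))) ≡ sum (λ a → degree (contract G) (suc a)) + commonNeighbours G
sum-degree-contract {n} G = begin
  sum (λ a → degree G (suc (suc a)))      ≡⟨ sum-cong-≗ (degree-contract G) ⟩
  sum (λ a → degree′ a + common a)        ≡⟨ ∑-distrib-+ degree′ common ⟩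
  sum degree′ + sum common                ≡⟨ cong (sum degree′ +_) (sum-cong-≗ common-sym) ⟩
  sum degree′ + sum (iverson ∘ adjacentToBoth G)
                                          ≡⟨ cong (sum degree′ +_) (countTrue≡sum (adjacentToBoth G)) ⟨
  sum degree′ + commonNeighbours G        ∎
  where
  open ≡-Reasoning
  degree′ : Fin n → ℕ
  degree′ a = degree (contract G) (suc a)
  common : Fin n → ℕ
  common a = iverson (adj G (suc (suc a)) zero ∧ adj G (suc (suc a)) (suc zero))
  common-sym : ∀ a → common a ≡ iverson (adjacentToBoth G a)
  common-sym a = cong iverson (cong₂ _∧_ (Graph.sym G (suc (suc a)) zero) (Graph.sym G (suc (suc a)) (suc zero)))

degreeSum-contract : ∀ {n} (G : Graph (2 + n)) →
  degreeSum G ≡ degreeSum (contract G) + 2 * (iverson (adj G zero (suc zero)) + commonNeighbours G)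
degreeSum-contract {n} G = begin
  degreeSum G
    ≡⟨ cong₂ _+_ (cong (λ x → iverson x + (e + X₀)) (irrefl G zero))
                 (cong₂ (λ x y → iverson x + (iverson y + X₁) + Rest)
                        (Graph.sym G (suc zero) zero) (irrefl G (suc zero))) ⟩
  (e + X₀) + ((e + X₁) + Rest)
    ≡⟨ cong (λ r → (e + X₀) + ((e + X₁) + r)) (sum-degree-contract G) ⟩
  (e + X₀) + ((e + X₁) + (Rest′ + C))
    ≡⟨ arith e X₀ X₁ Rest′ C ⟩
  (X₀ + X₁) + Rest′ + 2 * e + C
    ≡⟨ cong (λ x → x + Rest′ + 2 * e + C) (countTrue-∨-∧ f₀ f₁) ⟨
  (Y + C) + Rest′ + 2 * e + C
    ≡⟨ arith′ Y C Rest′ e ⟩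
  (Y + Rest′) + 2 * (e + C)
    ∎
  where
  open ≡-Reasoning
  f₀ f₁ : Fin n → Bool
  f₀ b = adj G zero (suc (suc b))
  f₁ b = adj G (suc zero) (suc (suc b))
  e  = iverson (adj G zero (suc zero))
  X₀ = countTrue f₀
  X₁ = countTrue f₁
  Y  = countTrue (λ b → f₀ b ∨ f₁ b)
  C  = commonNeighbours G
  Rest  = sum (λ a → degree G (suc (suc a)))
  Rest′ = sum (λ a → degree (contract G) (suc a))
  arith : ∀ e x₀ x₁ r c → (e + x₀) + ((e + x₁) + (r + c)) ≡ (x₀ + x₁) + r + 2 * e + c
  arith = solve-∀
  arith′ : ∀ y c r e → (y + c) + r + 2 * e + c ≡ (y + r) + 2 * (e + c)
  arith′ = solve-∀

nonCrossing⇒degreeSum≤ : ∀ n (G : Graph (2 + n)) → NonCrossing (adj G) → degreeSum G ≤ 4 * n + 2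
nonCrossing⇒degreeSum≤ zero G _ = begin
  degreeSum G                                ≡⟨ degreeSum-contract G ⟩
  2 * (iverson (adj G zero (suc zero)) + 0)  ≤⟨ *-monoʳ-≤ 2 (+-monoˡ-≤ 0 (iverson≤1 (adj G zero (suc zero)))) ⟩
  2                                          ∎
  where open ≤-Reasoning
nonCrossing⇒degreeSum≤ (suc n) G nonCrossing = begin
  degreeSum G
    ≡⟨ degreeSum-contract G ⟩
  degreeSum (contract G) + 2 * (iverson (adj G zero (suc zero)) + commonNeighbours G)
    ≤⟨ +-mono-≤ (nonCrossing⇒degreeSum≤ n (contract G) (contract-nonCrossing G nonCrossing))
                (*-monoʳ-≤ 2 (+-mono-≤ (iverson≤1 (adj G zero (suc zero))) (commonNeighbours≤1 G nonCrossing))) ⟩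
  (4 * n + 2) + 2 * (1 + 1)
    ≡⟨ arith n ⟩
  4 * suc n + 2
    ∎
  where
  open ≤-Reasoning
  arith : ∀ n → (4 * n + 2) + 2 * (1 + 1) ≡ 4 * suc n + 2
  arith = solve-∀

outerplanar⇒degreeSum≤ : ∀ {n} → 2 ≤ n → (G : Graph n) → Outerplanar G → degreeSum G + 6 ≤ 4 * n
outerplanar⇒degreeSum≤ {suc (suc n)} (s≤s (s≤s z≤n)) G outerplanar@(π , _) = begin
  degreeSum G + 6                     ≡⟨ cong (_+ 6) (degreeSum-relabel (flip π) G) ⟨
  degreeSum (relabel (flip π) G) + 6  ≤⟨ +-monoˡ-≤ 6 (nonCrossing⇒degreeSum≤ n (relabel (flip π) G)
                                                       (outerplanar⇒nonCrossing G outerplanar)) ⟩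
  4 * n + 2 + 6                       ≡⟨ arith n ⟩
  4 * suc (suc n)                     ∎
  where
  open ≤-Reasoning
  arith : ∀ n → 4 * n + 2 + 6 ≡ 4 * suc (suc n)
  arith = solve-∀

module _ {n} {G H : Graph n} {u v : Fin n} (u≢v : u ≢ v) (uv∉G : adj G u v ≡ false)
         (H=G+uv : IsAddEdge G u v H) where

  addEdge-adj : ∀ {x y} → ¬ ((x ≡ u × y ≡ v) ⊎ (x ≡ v × y ≡ u)) → adj H x y ≡ adj G x y
  addEdge-adj {x} {y} old with adj G x y in gxy | adj H x y in hxy
  ... | true  | true  = refl
  ... | false | false = refl
  ... | true  | false with () ← trans (sym hxy) (Equivalence.from (H=G+uv x y) (inj₁ gxy))
  ... | false | true  with Equivalence.to (H=G+uv x y) hxy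
  ...   | inj₁ gxy′ with () ← trans (sym gxy) gxy′
  ...   | inj₂ new = contradiction new old

  degree-addEdge : ∀ x → degree H x ≡ iverson (does (x Fin.≟ u)) + iverson (does (x Fin.≟ v)) + degree G x
  degree-addEdge x with x Fin.≟ u | x Fin.≟ v
  ... | yes refl | yes refl = contradiction refl u≢v
  ... | yes refl | no _ =
    countTrue-insert v uv∉G (Equivalence.from (H=G+uv u v) (inj₂ (inj₁ (refl , refl))))
      λ y y≢v → addEdge-adj {u} {y} λ { (inj₁ (_ , y≡v)) → y≢v y≡v ; (inj₂ (u≡v , _)) → u≢v u≡v }
  ... | no _ | yes refl =
    countTrue-insert u (trans (Graph.sym G v u) uv∉G) (Equivalence.from (H=G+uv v u) (inj₂ (inj₂ (refl , refl))))
      λ y y≢u → addEdge-adj {v} {y} λ { (inj₁ (v≡u , _)) → u≢v (sym v≡u) ; (inj₂ (_ , y≡u)) → y≢u y≡u }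
  ... | no x≢u | no x≢v =
    countTrue-cong λ y → addEdge-adj {x} {y} λ { (inj₁ (x≡u , _)) → x≢u x≡u ; (inj₂ (x≡v , _)) → x≢v x≡v }

  degreeSum-addEdge : degreeSum H ≡ 2 + degreeSum G
  degreeSum-addEdge = begin
    sum (degree H)                         ≡⟨ sum-cong-≗ degree-addEdge ⟩
    sum (λ x → δᵤ x + δᵥ x + degree G x)   ≡⟨ ∑-distrib-+ (λ x → δᵤ x + δᵥ x) (degree G) ⟩
    sum (λ x → δᵤ x + δᵥ x) + degreeSum G  ≡⟨ cong (_+ degreeSum G) (∑-distrib-+ δᵤ δᵥ) ⟩
    sum δᵤ + sum δᵥ + degreeSum G          ≡⟨ cong (_+ degreeSum G) (cong₂ _+_ (once u) (once v)) ⟩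
    2 + degreeSum G                        ∎
    where
    open ≡-Reasoning
    δᵤ δᵥ : Fin n → ℕ
    δᵤ x = iverson (does (x Fin.≟ u))
    δᵥ x = iverson (does (x Fin.≟ v))
    once : ∀ w → sum (λ x → iverson (does (x Fin.≟ w))) ≡ 1
    once w = trans (sym (countTrue≡sum (λ x → does (x Fin.≟ w)))) (countTrue-≟ w)

extremal⇒maximal : ∀ {n} → 2 ≤ n → (G : Graph n) → Outerplanar G → degreeSum G + 6 ≡ 4 * n →
                   MaximalOuterplanar G
extremal⇒maximal {n} 2≤n G outerplanar full = outerplanar , not-outerplanar
  where
  not-outerplanar : ∀ u v → u ≢ v → adj G u v ≡ false → ∀ H → IsAddEdge G u v H → ¬ Outerplanar H
  not-outerplanar u v u≢v uv∉G H H=G+uv outerplanarH = <-irrefl {4 * n} refl (begin-strict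
    4 * n                ≡⟨ full ⟨
    degreeSum G + 6      <⟨ m<n⇒m<1+n (n<1+n (degreeSum G + 6)) ⟩
    2 + degreeSum G + 6  ≡⟨ cong (_+ 6) (degreeSum-addEdge {G = G} {H} u≢v uv∉G H=G+uv) ⟨
    degreeSum H + 6      ≤⟨ outerplanar⇒degreeSum≤ 2≤n H outerplanarH ⟩
    4 * n                ∎)
    where open ≤-Reasoning


-- The doubling triangulations

sumBelow : ℕ → (ℕ → ℕ) → ℕ
sumBelow m f = sum {m} (f ∘ toℕ)

countBelow : ℕ → (ℕ → Bool) → ℕ
countBelow m g = countTrue {m} (g ∘ toℕ)

sumBelow-cong : ∀ m {f g : ℕ → ℕ} → (∀ k → k < m → f k ≡ g k) → sumBelow m f ≡ sumBelow m g
sumBelow-cong m f≗g = sum-cong-≗ (λ i → f≗g (toℕ i) (Fin.toℕ<n i))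

countBelow-cong : ∀ m {f g : ℕ → Bool} → (∀ k → k < m → f k ≡ g k) → countBelow m f ≡ countBelow m g
countBelow-cong m f≗g = countTrue-cong (λ i → f≗g (toℕ i) (Fin.toℕ<n i))

sumBelow-const : ∀ m c → sumBelow m (λ _ → c) ≡ m * c
sumBelow-const zero    c = refl
sumBelow-const (suc m) c = cong (c +_) (sumBelow-const m c)

sumBelow-split : ∀ m (f : ℕ → ℕ) →
                 sumBelow (2 * m) f ≡ sumBelow m (λ k → f (2 * k)) + sumBelow m (λ k → f (1 + 2 * k))
sumBelow-split zero    f = refl
sumBelow-split (suc m) f = begin
  sumBelow (2 * suc m) f
    ≡⟨ cong (λ k → sumBelow k f) (*-suc 2 m) ⟩
  f 0 + (f 1 + sumBelow (2 * m) (λ k → f (2 + k)))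
    ≡⟨ cong (λ s → f 0 + (f 1 + s)) (sumBelow-split m (λ k → f (2 + k))) ⟩
  f 0 + (f 1 + (sumBelow m (λ k → f (2 + 2 * k)) + sumBelow m (λ k → f (3 + 2 * k))))
    ≡⟨ interchange (f 0) (f 1) _ _ ⟩
  (f 0 + sumBelow m (λ k → f (2 + 2 * k))) + (f 1 + sumBelow m (λ k → f (3 + 2 * k)))
    ≡⟨ cong₂ (λ x y → (f 0 + x) + (f 1 + y)) (sumBelow-cong m (λ k _ → cong f (sym (*-suc 2 k))))
                                              (sumBelow-cong m (λ k _ → cong (λ x → f (1 + x)) (sym (*-suc 2 k)))) ⟩
  sumBelow (suc m) (λ k → f (2 * k)) + sumBelow (suc m) (λ k → f (1 + 2 * k))
    ∎
  where
  open ≡-Reasoning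
  interchange : ∀ a b c d → a + (b + (c + d)) ≡ (a + c) + (b + d)
  interchange = solve-∀

countBelow-split : ∀ m (g : ℕ → Bool) →
                   countBelow (2 * m) g ≡ countBelow m (λ k → g (2 * k)) + countBelow m (λ k → g (1 + 2 * k))
countBelow-split m g = begin
  countBelow (2 * m) g
    ≡⟨ countTrue≡sum {2 * m} (g ∘ toℕ) ⟩
  sumBelow (2 * m) (iverson ∘ g)
    ≡⟨ sumBelow-split m (iverson ∘ g) ⟩
  sumBelow m (λ k → iverson (g (2 * k))) + sumBelow m (λ k → iverson (g (1 + 2 * k)))
    ≡⟨ cong₂ _+_ (countTrue≡sum {m} (λ i → g (2 * toℕ i))) (countTrue≡sum {m} (λ i → g (1 + 2 * toℕ i))) ⟨
  countBelow m (λ k → g (2 * k)) + countBelow m (λ k → g (1 + 2 * k))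
    ∎
  where open ≡-Reasoning

countBelow-≟ : ∀ {m a} → a < m → countBelow m (λ y → does (y ≟ a)) ≡ 1
countBelow-≟ {m} {a} a<m = trans (countTrue-cong same) (countTrue-≟ (Fin.fromℕ< a<m))
  where
  same : ∀ i → does (toℕ i ≟ a) ≡ does (i Fin.≟ Fin.fromℕ< a<m)
  same i = does-⇔ (mk⇔ (λ i≡a → Fin.toℕ-injective (trans i≡a (sym (Fin.toℕ-fromℕ< a<m))))
                       (λ i≡a → trans (cong toℕ i≡a) (Fin.toℕ-fromℕ< a<m)))
                  (toℕ i ≟ a) (i Fin.≟ Fin.fromℕ< a<m)

countBelow-pair : ∀ {m a b} {P : ℕ → Set} (P? : ∀ y → Dec (P y)) → a ≢ b → a < m → b < m →
                  (∀ y → y < m → P y ⇔ (y ≡ a ⊎ y ≡ b)) → countBelow m (λ y → does (P? y)) ≡ 2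
countBelow-pair {m} {a} {b} P? a≢b a<m b<m P⇔ = begin
  countBelow m (λ y → does (P? y))
    ≡⟨ countBelow-cong m (λ y y<m → does-⇔ (P⇔ y y<m) (P? y) (y ≟ a ⊎-dec y ≟ b)) ⟩
  countBelow m (λ y → does (y ≟ a) ∨ does (y ≟ b))
    ≡⟨ countTrue-disjoint-∨ {m} (λ i → does (toℕ i ≟ a)) (λ i → does (toℕ i ≟ b)) disjoint ⟩
  countBelow m (λ y → does (y ≟ a)) + countBelow m (λ y → does (y ≟ b))
    ≡⟨ cong₂ _+_ (countBelow-≟ a<m) (countBelow-≟ b<m) ⟩
  2 ∎
  where
  open ≡-Reasoning
  disjoint : ∀ i → does (toℕ i ≟ a) ∧ does (toℕ i ≟ b) ≡ false
  disjoint i = does-exclusive (toℕ i ≟ a) (toℕ i ≟ b) (λ i≡a i≡b → a≢b (trans (sym i≡a) i≡b))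


CycleEdge : ℕ → ℕ → ℕ → Set
CycleEdge m x y = suc x ≡ y ⊎ suc y ≡ x ⊎ (x ≡ 0 × suc y ≡ m) ⊎ (y ≡ 0 × suc x ≡ m)

cycleEdge? : ∀ m x y → Dec (CycleEdge m x y)
cycleEdge? m x y = suc x ≟ y ⊎-dec suc y ≟ x ⊎-dec (x ≟ 0 ×-dec suc y ≟ m) ⊎-dec (y ≟ 0 ×-dec suc x ≟ m)

CycleEdge-sym : ∀ {m x y} → CycleEdge m x y → CycleEdge m y x
CycleEdge-sym (inj₁ e)               = inj₂ (inj₁ e)
CycleEdge-sym (inj₂ (inj₁ e))        = inj₁ e
CycleEdge-sym (inj₂ (inj₂ (inj₁ e))) = inj₂ (inj₂ (inj₂ e))
CycleEdge-sym (inj₂ (inj₂ (inj₂ e))) = inj₂ (inj₂ (inj₁ e))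

CycleEdge-irrefl : ∀ {m x} → 2 ≤ m → ¬ CycleEdge m x x
CycleEdge-irrefl _   (inj₁ e)                           = 1+n≢n e
CycleEdge-irrefl _   (inj₂ (inj₁ e))                    = 1+n≢n e
CycleEdge-irrefl 2≤m (inj₂ (inj₂ (inj₁ (refl , refl)))) = <-irrefl refl 2≤m
CycleEdge-irrefl 2≤m (inj₂ (inj₂ (inj₂ (refl , refl)))) = <-irrefl refl 2≤m

CycleEdge-not-outer : ∀ {m a b c d} → CycleEdge m a b → a < c → c < b → b < d → d < m → ⊥
CycleEdge-not-outer (inj₁ refl)                      a<c c<b _   _   = ≤⇒≯ (≤-pred c<b) a<c
CycleEdge-not-outer (inj₂ (inj₁ refl))               a<c c<b _   _   = <-asym a<c (<-trans c<b (n<1+n _))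
CycleEdge-not-outer (inj₂ (inj₂ (inj₁ (_ , refl)))) _   _   b<d d<m = ≤⇒≯ (≤-pred d<m) b<d
CycleEdge-not-outer (inj₂ (inj₂ (inj₂ (refl , _)))) _   ()  _   _

CycleEdge-not-inner : ∀ {m a b c d} → CycleEdge m c d → a < c → c < b → b < d → ⊥
CycleEdge-not-inner (inj₁ refl)                      _  c<b b<d = ≤⇒≯ (≤-pred b<d) c<b
CycleEdge-not-inner (inj₂ (inj₁ refl))               _  c<b b<d = <-asym c<b (<-trans b<d (n<1+n _))
CycleEdge-not-inner (inj₂ (inj₂ (inj₁ (refl , _)))) ()  _   _
CycleEdge-not-inner (inj₂ (inj₂ (inj₂ (refl , _)))) _   _   ()

CycleEdge-degree : ∀ {m x} → 3 ≤ m → x < m → countBelow m (λ y → does (cycleEdge? m x y)) ≡ 2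
CycleEdge-degree {suc (suc (suc k))} (s≤s (s≤s (s≤s _))) = two-neighbours
  where
  two-neighbours : ∀ {x} → x < 3 + k → countBelow (3 + k) (λ y → does (cycleEdge? (3 + k) x y)) ≡ 2
  two-neighbours {zero} _ = countBelow-pair (cycleEdge? (3 + k) 0) (λ ()) (s≤s (s≤s z≤n)) ≤-refl
    λ y _ → mk⇔ (λ { (inj₁ refl)                  → inj₁ refl
                   ; (inj₂ (inj₁ ()))
                   ; (inj₂ (inj₂ (inj₁ (_ , e)))) → inj₂ (suc-injective e)
                   ; (inj₂ (inj₂ (inj₂ (_ , ())))) })
                (λ { (inj₁ refl) → inj₁ refl ; (inj₂ refl) → inj₂ (inj₂ (inj₁ (refl , refl))) })
  two-neighbours {suc x} x<m with m≤n⇒m<n∨m≡n (≤-pred x<m)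
  ... | inj₂ refl = countBelow-pair (cycleEdge? (3 + k) (suc x)) (λ ()) (s≤s z≤n) (<-trans (n<1+n x) x<m)
    λ y y<m → mk⇔ (λ { (inj₁ refl)                     → contradiction y<m (<-irrefl refl)
                     ; (inj₂ (inj₁ refl))              → inj₂ refl
                     ; (inj₂ (inj₂ (inj₁ (() , _))))
                     ; (inj₂ (inj₂ (inj₂ (refl , _)))) → inj₁ refl })
                  (λ { (inj₁ refl) → inj₂ (inj₂ (inj₂ (refl , refl))) ; (inj₂ refl) → inj₂ (inj₁ refl) })
  ... | inj₁ 1+x<2+k = countBelow-pair (cycleEdge? (3 + k) (suc x)) (λ ()) (s≤s 1+x<2+k) (<-trans (n<1+n x) x<m)
    λ y _ → mk⇔ (λ { (inj₁ refl)                  → inj₁ refl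
                   ; (inj₂ (inj₁ refl))           → inj₂ refl
                   ; (inj₂ (inj₂ (inj₁ (() , _))))
                   ; (inj₂ (inj₂ (inj₂ (_ , e)))) → contradiction (suc-injective e) (<⇒≢ 1+x<2+k) })
                (λ { (inj₁ refl) → inj₁ refl ; (inj₂ refl) → inj₂ (inj₁ refl) })

data EvenOdd : ℕ → Set where
  even : ∀ k → EvenOdd (2 * k)
  odd  : ∀ k → EvenOdd (1 + 2 * k)

evenOdd : ∀ n → EvenOdd n
evenOdd zero = even 0
evenOdd (suc n) with evenOdd n
... | even k = odd k
... | odd k  = subst EvenOdd (*-suc 2 k) (even (suc k))

Lift : (ℕ → ℕ → Set) → ℕ → ℕ → Set
Lift E x y = ∃₂ λ k j → x ≡ 2 * k × y ≡ 2 * j × E k j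

module _ {E : ℕ → ℕ → Set} where

  Lift-double : ∀ {k j} → Lift E (2 * k) (2 * j) ⇔ E k j
  Lift-double {k} {j} = mk⇔
    (λ (k′ , j′ , p , q , e) → subst₂ E (*-cancelˡ-≡ k′ k 2 (sym p)) (*-cancelˡ-≡ j′ j 2 (sym q)) e)
    (λ e → k , j , refl , refl , e)

  Lift-oddˡ : ∀ {k y} → ¬ Lift E (1 + 2 * k) y
  Lift-oddˡ {k} (k′ , _ , p , _) = even≢odd k′ k (sym p)

  Lift-oddʳ : ∀ {x j} → ¬ Lift E x (1 + 2 * j)
  Lift-oddʳ {j = j} (_ , j′ , _ , q , _) = even≢odd j′ j (sym q)

  lift? : (∀ k j → Dec (E k j)) → ∀ x y → Dec (Lift E x y)
  lift? E? x y with evenOdd x | evenOdd y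
  ... | even k | even j = map′ (Equivalence.from Lift-double) (Equivalence.to Lift-double) (E? k j)
  ... | even _ | odd j  = no (Lift-oddʳ {j = j})
  ... | odd k  | _      = no (Lift-oddˡ {k})

  Lift-sym : (∀ {k j} → E k j → E j k) → ∀ {x y} → Lift E x y → Lift E y x
  Lift-sym E-sym (k , j , p , q , e) = j , k , q , p , E-sym e

  Lift-disjoint-CycleEdge : ∀ {m x y} → Lift E x y → ¬ CycleEdge (2 * m) x y
  Lift-disjoint-CycleEdge     (k , j , refl , refl , _) (inj₁ e)                     = even≢odd j k (sym e)
  Lift-disjoint-CycleEdge     (k , j , refl , refl , _) (inj₂ (inj₁ e))              = even≢odd k j (sym e)
  Lift-disjoint-CycleEdge {m} (k , j , refl , refl , _) (inj₂ (inj₂ (inj₁ (_ , e)))) = even≢odd m j (sym e)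
  Lift-disjoint-CycleEdge {m} (k , j , refl , refl , _) (inj₂ (inj₂ (inj₂ (_ , e)))) = even≢odd m k (sym e)

-- The edge relation of the triangulation of the polygon 0, 1, …, 2 ^ (1 + t) − 1: the single edge
-- {0, 1} for t = 0 (CycleEdge 2 adds nothing else below 2), and for t + 1 the copy of level t on the
-- even vertices together with the boundary cycle.
Triangulation : ℕ → ℕ → ℕ → Set
Triangulation zero    x y = CycleEdge 2 x y
Triangulation (suc t) x y = Lift (Triangulation t) x y ⊎ CycleEdge (2 ^ (2 + t)) x y

triangulation? : ∀ t x y → Dec (Triangulation t x y)
triangulation? zero        = cycleEdge? 2
triangulation? (suc t) x y = lift? (triangulation? t) x y ⊎-dec cycleEdge? (2 ^ (2 + t)) x y

2≤2^[1+t] : ∀ t → 2 ≤ 2 ^ (1 + t)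
2≤2^[1+t] t = *-monoʳ-≤ 2 (m^n>0 2 t)

Triangulation-sym : ∀ t {x y} → Triangulation t x y → Triangulation t y x
Triangulation-sym zero                  = CycleEdge-sym
Triangulation-sym (suc t) (inj₁ lifted) = inj₁ (Lift-sym (Triangulation-sym t) lifted)
Triangulation-sym (suc t) (inj₂ cycle)  = inj₂ (CycleEdge-sym cycle)

Triangulation-irrefl : ∀ t {x} → ¬ Triangulation t x x
Triangulation-irrefl zero = CycleEdge-irrefl ≤-refl
Triangulation-irrefl (suc t) (inj₁ (k , j , p , q , e)) =
  Triangulation-irrefl t (subst (Triangulation t k) (*-cancelˡ-≡ j k 2 (trans (sym q) p)) e)
Triangulation-irrefl (suc t) (inj₂ cycle) = CycleEdge-irrefl (2≤2^[1+t] (suc t)) cycle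

Triangulation-nonCrossing : ∀ t {a b c d} → a < c → c < b → b < d → d < 2 ^ (1 + t) →
                            Triangulation t a b → Triangulation t c d → ⊥
Triangulation-nonCrossing zero    a<c c<b b<d d<m ab        _         = CycleEdge-not-outer ab a<c c<b b<d d<m
Triangulation-nonCrossing (suc t) a<c c<b b<d d<m (inj₂ ab) _         = CycleEdge-not-outer ab a<c c<b b<d d<m
Triangulation-nonCrossing (suc t) a<c c<b b<d _   _         (inj₂ cd) = CycleEdge-not-inner cd a<c c<b b<d
Triangulation-nonCrossing (suc t) a<c c<b b<d d<m (inj₁ (a′ , b′ , refl , refl , ab)) (inj₁ (c′ , d′ , refl , refl , cd)) =
  Triangulation-nonCrossing t (*-cancelˡ-< 2 a′ c′ a<c) (*-cancelˡ-< 2 c′ b′ c<b) (*-cancelˡ-< 2 b′ d′ b<d)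
                              (*-cancelˡ-< 2 d′ (2 ^ (1 + t)) d<m) ab cd

triangulation : ∀ t → Graph (2 ^ (1 + t))
triangulation t = record
  { adj    = λ p q → does (triangulation? t (toℕ p) (toℕ q))
  ; sym    = λ p q → does-⇔ (mk⇔ (Triangulation-sym t) (Triangulation-sym t)) (triangulation? t _ _)
                                                                             (triangulation? t _ _)
  ; irrefl = λ p → dec-false (triangulation? t _ _) (Triangulation-irrefl t)
  }

triangulation-nonCrossing : ∀ t → NonCrossing (adj (triangulation t))
triangulation-nonCrossing t a b c d ab cd (a<c , c<b , b<d) =
  Triangulation-nonCrossing t a<c c<b b<d (Fin.toℕ<n d) (does⇒ (triangulation? t _ _) ab)
                                                        (does⇒ (triangulation? t _ _) cd)

degreeAt : ℕ → ℕ → ℕ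
degreeAt t x = countBelow (2 ^ (1 + t)) (λ y → does (triangulation? t x y))

module _ (t : ℕ) where

  private
    N = 2 ^ (1 + t)
    E? = triangulation? t

    lift-and-cycle : ∀ x → degreeAt (suc t) x ≡
      countBelow (2 * N) (λ y → does (lift? E? x y)) + countBelow (2 * N) (λ y → does (cycleEdge? (2 * N) x y))
    lift-and-cycle x =
      countTrue-disjoint-∨ {2 * N} (λ i → does (lift? E? x (toℕ i))) (λ i → does (cycleEdge? (2 * N) x (toℕ i)))
        λ i → does-exclusive (lift? E? x (toℕ i)) (cycleEdge? (2 * N) x (toℕ i)) (Lift-disjoint-CycleEdge {m = N})

    cycle-part : ∀ {x} → x < 2 * N → countBelow (2 * N) (λ y → does (cycleEdge? (2 * N) x y)) ≡ 2
    cycle-part = CycleEdge-degree (≤-trans (n≤1+n 3) (*-monoʳ-≤ 2 (2≤2^[1+t] t)))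

  degreeAt-double : ∀ {k} → k < N → degreeAt (suc t) (2 * k) ≡ degreeAt t k + 2
  degreeAt-double {k} k<N = begin
    degreeAt (suc t) (2 * k)                                  ≡⟨ lift-and-cycle (2 * k) ⟩
    countBelow (2 * N) (λ y → does (lift? E? (2 * k) y)) + _  ≡⟨ cong₂ _+_ lift-part (cycle-part (*-monoʳ-< 2 k<N)) ⟩
    degreeAt t k + 2                                          ∎
    where
    open ≡-Reasoning
    lift-part : countBelow (2 * N) (λ y → does (lift? E? (2 * k) y)) ≡ degreeAt t k
    lift-part = begin
      countBelow (2 * N) (λ y → does (lift? E? (2 * k) y))
        ≡⟨ countBelow-split N (λ y → does (lift? E? (2 * k) y)) ⟩
      countBelow N (λ j → does (lift? E? (2 * k) (2 * j))) + countBelow N (λ j → does (lift? E? (2 * k) (1 + 2 * j)))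
        ≡⟨ cong₂ _+_
             (countTrue-cong {N} λ j → does-⇔ (Lift-double {k = k} {toℕ j}) (lift? E? (2 * k) (2 * toℕ j)) (E? k (toℕ j)))
             (countTrue-false {N} λ j → dec-false (lift? E? (2 * k) (1 + 2 * toℕ j)) (Lift-oddʳ {j = toℕ j})) ⟩
      degreeAt t k + 0
        ≡⟨ +-identityʳ _ ⟩
      degreeAt t k
        ∎

  degreeAt-odd : ∀ {k} → 1 + 2 * k < 2 * N → degreeAt (suc t) (1 + 2 * k) ≡ 2
  degreeAt-odd {k} x<2N = begin
    degreeAt (suc t) (1 + 2 * k)                                  ≡⟨ lift-and-cycle (1 + 2 * k) ⟩
    countBelow (2 * N) (λ y → does (lift? E? (1 + 2 * k) y)) + _  ≡⟨ cong₂ _+_ lift-part (cycle-part x<2N) ⟩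
    2                                                             ∎
    where
    open ≡-Reasoning
    lift-part : countBelow (2 * N) (λ y → does (lift? E? (1 + 2 * k) y)) ≡ 0
    lift-part = countTrue-false {2 * N} λ j → dec-false (lift? E? (1 + 2 * k) (toℕ j)) (Lift-oddˡ {k = k})

odd<double : ∀ {k n} → k < n → 1 + 2 * k < 2 * n
odd<double {k} {n} k<n = subst (_≤ 2 * n) (*-suc 2 k) (*-monoʳ-≤ 2 k<n)

degreeAt-bound : ∀ t {x} → x < 2 ^ (1 + t) → degreeAt t x ≤ 1 + 2 * t
degreeAt-bound zero    {0}           _ = ≤-refl
degreeAt-bound zero    {1}           _ = ≤-refl
degreeAt-bound zero    {suc (suc x)} (s≤s (s≤s ()))
degreeAt-bound (suc t) {x} = by-parity (evenOdd x)
  where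
  by-parity : ∀ {x} → EvenOdd x → x < 2 ^ (2 + t) → degreeAt (suc t) x ≤ 1 + 2 * suc t
  by-parity (even k) x<2N = begin
    degreeAt (suc t) (2 * k)  ≡⟨ degreeAt-double t k<N ⟩
    degreeAt t k + 2          ≤⟨ +-monoˡ-≤ 2 (degreeAt-bound t k<N) ⟩
    1 + 2 * t + 2             ≡⟨ arith t ⟩
    1 + 2 * suc t             ∎
    where
    open ≤-Reasoning
    k<N = *-cancelˡ-< 2 k (2 ^ (1 + t)) x<2N
    arith : ∀ t → 1 + 2 * t + 2 ≡ 1 + 2 * suc t
    arith = solve-∀
  by-parity (odd k) x<2N = ≤-trans (≤-reflexive (degreeAt-odd t {k} x<2N)) (s≤s (s≤s z≤n))

degreeAt-zero : ∀ t → degreeAt t 0 ≡ 1 + 2 * t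
degreeAt-zero zero    = refl
degreeAt-zero (suc t) = begin
  degreeAt (suc t) 0  ≡⟨ degreeAt-double t (m^n>0 2 (1 + t)) ⟩
  degreeAt t 0 + 2    ≡⟨ cong (_+ 2) (degreeAt-zero t) ⟩
  1 + 2 * t + 2       ≡⟨ arith t ⟩
  1 + 2 * suc t       ∎
  where
  open ≡-Reasoning
  arith : ∀ t → 1 + 2 * t + 2 ≡ 1 + 2 * suc t
  arith = solve-∀

degreeAt-sum : ∀ t → sumBelow (2 ^ (1 + t)) (degreeAt t) + 6 ≡ 4 * 2 ^ (1 + t)
degreeAt-sum zero    = refl
degreeAt-sum (suc t) = begin
  sumBelow (2 * N) (degreeAt (suc t)) + 6
    ≡⟨ cong (_+ 6) (sumBelow-split N (degreeAt (suc t))) ⟩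
  sumBelow N (λ k → degreeAt (suc t) (2 * k)) + sumBelow N (λ k → degreeAt (suc t) (1 + 2 * k)) + 6
    ≡⟨ cong (_+ 6) (cong₂ _+_ (sumBelow-cong N (λ k → degreeAt-double t {k}))
                              (sumBelow-cong N (λ k → degreeAt-odd t {k} ∘ odd<double))) ⟩
  sumBelow N (λ k → degreeAt t k + 2) + sumBelow N (λ _ → 2) + 6
    ≡⟨ cong (λ s → s + sumBelow N (λ _ → 2) + 6) (∑-distrib-+ {N} (degreeAt t ∘ toℕ) (λ _ → 2)) ⟩
  sumBelow N (degreeAt t) + sumBelow N (λ _ → 2) + sumBelow N (λ _ → 2) + 6
    ≡⟨ cong (λ c → sumBelow N (degreeAt t) + c + c + 6) (sumBelow-const N 2) ⟩
  sumBelow N (degreeAt t) + N * 2 + N * 2 + 6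
    ≡⟨ arith (sumBelow N (degreeAt t)) N ⟩
  (sumBelow N (degreeAt t) + 6) + 4 * N
    ≡⟨ cong (_+ 4 * N) (degreeAt-sum t) ⟩
  4 * N + 4 * N
    ≡⟨ arith′ N ⟩
  4 * (2 * N)
    ∎
  where
  open ≡-Reasoning
  N = 2 ^ (1 + t)
  arith : ∀ s n → s + n * 2 + n * 2 + 6 ≡ (s + 6) + 4 * n
  arith = solve-∀
  arith′ : ∀ n → 4 * n + 4 * n ≡ 4 * (2 * n)
  arith′ = solve-∀

-- Congruences

infix 4 _≡_mod_
_≡_mod_ : ℕ → ℕ → ℕ → Set
x ≡ y mod m = ∃₂ λ k l → x + k * m ≡ y + l * m

module _ {m : ℕ} where

  mod-reflexive : ∀ {x y} → x ≡ y → x ≡ y mod m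
  mod-reflexive refl = 0 , 0 , refl

  mod-refl : ∀ {x} → x ≡ x mod m
  mod-refl = mod-reflexive refl

  mod-sym : ∀ {x y} → x ≡ y mod m → y ≡ x mod m
  mod-sym (k , l , eq) = l , k , sym eq

  mod-trans : ∀ {x y z} → x ≡ y mod m → y ≡ z mod m → x ≡ z mod m
  mod-trans {x} {y} {z} (k , l , x≈y) (k′ , l′ , y≈z) = k + k′ , l + l′ , +-cancelˡ-≡ y _ _ (begin
    y + (x + (k + k′) * m)      ≡⟨ arith y x k k′ m ⟩
    (x + k * m) + (y + k′ * m)  ≡⟨ cong₂ _+_ x≈y y≈z ⟩
    (y + l * m) + (z + l′ * m)  ≡⟨ arith′ y z l l′ m ⟩
    y + (z + (l + l′) * m)      ∎)
    where
    open ≡-Reasoning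
    arith : ∀ y x k k′ m → y + (x + (k + k′) * m) ≡ (x + k * m) + (y + k′ * m)
    arith = solve-∀
    arith′ : ∀ y z l l′ m → (y + l * m) + (z + l′ * m) ≡ y + (z + (l + l′) * m)
    arith′ = solve-∀

  +-cong-mod : ∀ {x x′ y y′} → x ≡ x′ mod m → y ≡ y′ mod m → x + y ≡ x′ + y′ mod m
  +-cong-mod {x} {x′} {y} {y′} (k , l , x≈x′) (k′ , l′ , y≈y′) = k + k′ , l + l′ , (begin
    x + y + (k + k′) * m          ≡⟨ arith x y k k′ m ⟩
    (x + k * m) + (y + k′ * m)    ≡⟨ cong₂ _+_ x≈x′ y≈y′ ⟩
    (x′ + l * m) + (y′ + l′ * m)  ≡⟨ arith x′ y′ l l′ m ⟨
    x′ + y′ + (l + l′) * m        ∎)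
    where
    open ≡-Reasoning
    arith : ∀ x y k k′ m → x + y + (k + k′) * m ≡ (x + k * m) + (y + k′ * m)
    arith = solve-∀

  *-congˡ-mod : ∀ c {x y} → x ≡ y mod m → c * x ≡ c * y mod m
  *-congˡ-mod c {x} {y} (k , l , x≈y) = c * k , c * l , (begin
    c * x + c * k * m  ≡⟨ arith c x k m ⟩
    c * (x + k * m)    ≡⟨ cong (c *_) x≈y ⟩
    c * (y + l * m)    ≡⟨ arith c y l m ⟨
    c * y + c * l * m  ∎)
    where
    open ≡-Reasoning
    arith : ∀ c x k m → c * x + c * k * m ≡ c * (x + k * m)
    arith = solve-∀

  *-congʳ-mod : ∀ c {x y} → x ≡ y mod m → x * c ≡ y * c mod m
  *-congʳ-mod c {x} {y} x≈y = subst₂ (λ x′ y′ → x′ ≡ y′ mod m) (*-comm c x) (*-comm c y) (*-congˡ-mod c x≈y)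

  +-cancelˡ-mod : ∀ z {x y} → z + x ≡ z + y mod m → x ≡ y mod m
  +-cancelˡ-mod z {x} {y} (k , l , eq) =
    k , l , +-cancelˡ-≡ z _ _ (trans (sym (+-assoc z x (k * m))) (trans eq (+-assoc z y (l * m))))

  multiple-mod : ∀ x k → x + k * m ≡ x mod m
  multiple-mod x k = 0 , k , +-identityʳ (x + k * m)

  mod-% : .{{_ : NonZero m}} → ∀ x → x % m ≡ x mod m
  mod-% x = x / m , 0 , trans (sym (m≡m%n+[m/n]*n x m)) (sym (+-identityʳ x))

  mod⇒%≡ : .{{_ : NonZero m}} → ∀ {x y} → x ≡ y mod m → x % m ≡ y % m
  mod⇒%≡ {x} {y} (k , l , eq) = trans (sym ([m+kn]%n≡m%n x k m)) (trans (cong (_% m) eq) ([m+kn]%n≡m%n y l m))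

  %≡⇒mod : .{{_ : NonZero m}} → ∀ {x y} → x % m ≡ y % m → x ≡ y mod m
  %≡⇒mod {x} {y} x%≡y% = mod-trans (mod-sym (mod-% x)) (mod-trans (mod-reflexive x%≡y%) (mod-% y))

  mod-< : .{{_ : NonZero m}} → ∀ {x y} → x < m → y < m → x ≡ y mod m → x ≡ y
  mod-< x<m y<m x≈y = trans (sym (m<n⇒m%n≡m x<m)) (trans (mod⇒%≡ x≈y) (m<n⇒m%n≡m y<m))

mod-∣ : ∀ {d m x y} → d ∣ m → x ≡ y mod m → x ≡ y mod d
mod-∣ {d} {m} {x} {y} (divides q refl) (k , l , eq) = k * q , l * q ,
  trans (cong (x +_) (*-assoc k q d)) (trans eq (cong (y +_) (sym (*-assoc l q d))))

*-cancelˡ-mod : ∀ c .{{_ : NonZero c}} {m x y} → c * x ≡ c * y mod c * m → x ≡ y mod m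
*-cancelˡ-mod c {m} {x} {y} (k , l , eq) =
  k , l , *-cancelˡ-≡ _ _ c (trans (arith c x k m) (trans eq (sym (arith c y l m))))
  where
  arith : ∀ c x k m → c * (x + k * m) ≡ c * x + k * (c * m)
  arith = solve-∀

mod-setoid : ℕ → Setoid 0ℓ 0ℓ
mod-setoid m = record
  { Carrier       = ℕ
  ; _≈_           = λ x y → x ≡ y mod m
  ; isEquivalence = record { refl = mod-refl ; sym = mod-sym ; trans = mod-trans }
  }

module mod-Reasoning (m : ℕ) = SetoidReasoning (mod-setoid m)

m≡m%2+2*[m/2] : ∀ a → a ≡ a % 2 + 2 * (a / 2)
m≡m%2+2*[m/2] a = trans (m≡m%n+[m/n]*n a 2) (cong (a % 2 +_) (*-comm (a / 2) 2))

%2-/2-injective : ∀ {a a′} → a % 2 ≡ a′ % 2 → a / 2 ≡ a′ / 2 → a ≡ a′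
%2-/2-injective {a} {a′} b≡b′ q≡q′ =
  trans (m≡m%2+2*[m/2] a) (trans (cong₂ (λ b q → b + 2 * q) b≡b′ q≡q′) (sym (m≡m%2+2*[m/2] a′)))

a<2^[1+s]⇒a/2<2^s : ∀ {a s} → a < 2 ^ (1 + s) → a / 2 < 2 ^ s
a<2^[1+s]⇒a/2<2^s {a} {s} a< = m<n*o⇒m/o<n (subst (a <_) (*-comm 2 (2 ^ s)) a<)

b+2x≡b-mod-2 : ∀ b x → b + 2 * x ≡ b mod 2
b+2x≡b-mod-2 b x = subst (λ z → b + z ≡ b mod 2) (*-comm x 2) (multiple-mod b x)

halve-mod : ∀ {m b b′ x y} → b < 2 → b′ < 2 → b + 2 * x ≡ b′ + 2 * y mod 2 * m → (b ≡ b′) × x ≡ y mod m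
halve-mod {m} {b} {b′} {x} {y} b<2 b′<2 b+2x≈b′+2y = b≡b′ , *-cancelˡ-mod 2 (+-cancelˡ-mod b b+2x≈b+2y)
  where
  b≡b′ : b ≡ b′
  b≡b′ = mod-< b<2 b′<2 (begin
    b             ≈⟨ b+2x≡b-mod-2 b x ⟨
    b + 2 * x     ≈⟨ mod-∣ (divides m (*-comm 2 m)) b+2x≈b′+2y ⟩
    b′ + 2 * y    ≈⟨ b+2x≡b-mod-2 b′ y ⟩
    b′            ∎)
    where open mod-Reasoning 2
  b+2x≈b+2y : b + 2 * x ≡ b + 2 * y mod 2 * m
  b+2x≈b+2y = subst (λ c → b + 2 * x ≡ c + 2 * y mod 2 * m) (sym b≡b′) b+2x≈b′+2y

0≢1-mod-2 : ¬ (0 ≡ 1 mod 2)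
0≢1-mod-2 0≈1 = contradiction (mod-< (s≤s z≤n) (s≤s (s≤s z≤n)) 0≈1) λ ()


odd-power : ∀ k t → ∃ λ u → (1 + 2 * t) ^ (2 ^ k) ≡ 1 + 2 ^ (1 + k) * u
odd-power zero    t = t , arith t
  where
  arith : ∀ t → (1 + 2 * t) * 1 ≡ 1 + (2 * 1) * t
  arith = solve-∀
odd-power (suc k) t =
  let u , h^2^k≡ = odd-power k t
  in  u + 2 ^ k * (u * u) , (begin
    (1 + 2 * t) ^ (2 ^ suc k)                ≡⟨ cong ((1 + 2 * t) ^_) (*-comm 2 (2 ^ k)) ⟩
    (1 + 2 * t) ^ (2 ^ k * 2)                ≡⟨ ^-*-assoc (1 + 2 * t) (2 ^ k) 2 ⟨
    ((1 + 2 * t) ^ (2 ^ k)) ^ 2              ≡⟨ cong (_^ 2) h^2^k≡ ⟩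
    (1 + 2 ^ (1 + k) * u) ^ 2                ≡⟨ square (2 ^ k) u ⟩
    1 + 2 ^ (2 + k) * (u + 2 ^ k * (u * u))  ∎)
  where
  open ≡-Reasoning
  square : ∀ p u → (1 + (2 * p) * u) * ((1 + (2 * p) * u) * 1) ≡ 1 + (2 * (2 * p)) * (u + p * (u * u))
  square = solve-∀

odd-invertible : ∀ k t → ∃ λ w → (1 + 2 * t) * w ≡ 1 mod 2 ^ (1 + k)
odd-invertible k t =
  let u , h^2^k≡ = odd-power k t
  in  (1 + 2 * t) ^ (2 ^ k ∸ 1) , 0 , u , (begin
    (1 + 2 * t) * (1 + 2 * t) ^ (2 ^ k ∸ 1) + 0  ≡⟨ +-identityʳ _ ⟩
    (1 + 2 * t) ^ (1 + (2 ^ k ∸ 1))              ≡⟨ cong ((1 + 2 * t) ^_) (m+[n∸m]≡n (m^n>0 2 k)) ⟩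
    (1 + 2 * t) ^ (2 ^ k)                        ≡⟨ h^2^k≡ ⟩
    1 + 2 ^ (1 + k) * u                          ≡⟨ cong (1 +_) (*-comm (2 ^ (1 + k)) u) ⟩
    1 + u * 2 ^ (1 + k)                          ∎)
  where open ≡-Reasoning


module _ {m : ℕ} .{{_ : NonZero m}} where

  reduce : ℕ → Fin m
  reduce x = Fin.fromℕ< (m%n<n x m)

  toℕ-reduce : ∀ x → toℕ (reduce x) ≡ x mod m
  toℕ-reduce x = mod-trans (mod-reflexive (Fin.toℕ-fromℕ< (m%n<n x m))) (mod-% x)

  reduce-cong : ∀ {x y} → x ≡ y mod m → reduce x ≡ reduce y
  reduce-cong x≈y = Fin.toℕ-injective (trans (Fin.toℕ-fromℕ< _) (trans (mod⇒%≡ x≈y) (sym (Fin.toℕ-fromℕ< _))))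

  reduce-toℕ : ∀ i → reduce (toℕ i) ≡ i
  reduce-toℕ i = Fin.toℕ-injective (trans (Fin.toℕ-fromℕ< _) (m<n⇒m%n≡m (Fin.toℕ<n i)))

  Respects-mod : (ℕ → ℕ) → Set
  Respects-mod f = ∀ {x y} → x ≡ y mod m → f x ≡ f y mod m

  -- σ ⟨$⟩ˡ applies f and σ ⟨$⟩ʳ applies g.
  permutation-mod : (f g : ℕ → ℕ) → Respects-mod f → Respects-mod g →
                    (∀ x → f (g x) ≡ x mod m) → (∀ x → g (f x) ≡ x mod m) → Permutation′ m
  permutation-mod f g f-cong g-cong f∘g g∘f =
    permutation (reduce ∘ g ∘ toℕ) (reduce ∘ f ∘ toℕ) (inverse g-cong g∘f) (inverse f-cong f∘g)
    where
    inverse : ∀ {f g : ℕ → ℕ} → Respects-mod f → (∀ x → f (g x) ≡ x mod m) →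
              ∀ i → reduce (f (toℕ (reduce (g (toℕ i))))) ≡ i
    inverse {f} {g} f-cong f∘g i =
      trans (reduce-cong (mod-trans (f-cong (toℕ-reduce (g (toℕ i)))) (f∘g (toℕ i)))) (reduce-toℕ i)

  -- The inverse of x ↦ a + h x is y ↦ w (y − a), with − a represented by m ∸ a.
  module _ (a h w : ℕ) (a≤m : a ≤ m) (hw≡1 : h * w ≡ 1 mod m) where

    private
      a+[m∸a] : a + (m ∸ a) ≡ 1 * m
      a+[m∸a] = trans (m+[n∸m]≡n a≤m) (sym (*-identityˡ m))

    affine-inverseˡ : ∀ y → a + h * (w * (y + (m ∸ a))) ≡ y mod m
    affine-inverseˡ y = begin
      a + h * (w * (y + (m ∸ a)))  ≡⟨ cong (a +_) (*-assoc h w (y + (m ∸ a))) ⟨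
      a + h * w * (y + (m ∸ a))    ≈⟨ +-cong-mod (mod-refl {x = a}) (*-congʳ-mod (y + (m ∸ a)) hw≡1) ⟩
      a + 1 * (y + (m ∸ a))        ≡⟨ cong (a +_) (*-identityˡ (y + (m ∸ a))) ⟩
      a + (y + (m ∸ a))            ≡⟨ left-comm a y (m ∸ a) ⟩
      y + (a + (m ∸ a))            ≡⟨ cong (y +_) a+[m∸a] ⟩
      y + 1 * m                    ≈⟨ multiple-mod y 1 ⟩
      y                            ∎
      where
      open mod-Reasoning m
      left-comm : ∀ a y d → a + (y + d) ≡ y + (a + d)
      left-comm = solve-∀

    affine-inverseʳ : ∀ x → w * (a + h * x + (m ∸ a)) ≡ x mod m
    affine-inverseʳ x = begin
      w * (a + h * x + (m ∸ a))    ≡⟨ cong (w *_) (right-comm a (h * x) (m ∸ a)) ⟩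
      w * (h * x + (a + (m ∸ a)))  ≡⟨ cong (λ c → w * (h * x + c)) a+[m∸a] ⟩
      w * (h * x + 1 * m)          ≈⟨ *-congˡ-mod w (multiple-mod (h * x) 1) ⟩
      w * (h * x)                  ≡⟨ arith w h x ⟩
      h * w * x                    ≈⟨ *-congʳ-mod x hw≡1 ⟩
      1 * x                        ≡⟨ *-identityˡ x ⟩
      x                            ∎
      where
      open mod-Reasoning m
      right-comm : ∀ a z d → a + z + d ≡ z + (a + d)
      right-comm = solve-∀
      arith : ∀ w h x → w * (h * x) ≡ h * w * x
      arith = solve-∀

    affinePermutation : Permutation′ m
    affinePermutation = permutation-mod (λ x → a + h * x) (λ y → w * (y + (m ∸ a)))
      (λ x≈y → +-cong-mod (mod-refl {x = a}) (*-congˡ-mod h x≈y))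
      (λ x≈y → *-congˡ-mod w (+-cong-mod x≈y mod-refl))
      affine-inverseˡ affine-inverseʳ

-- Edge-disjointness of the affine images

-- multiplier s a = 1 + 4 · rev(a), where rev reverses the s binary digits of a.
multiplier : ℕ → ℕ → ℕ
multiplier zero    a = 1
multiplier (suc s) a = multiplier s (a / 2) + a % 2 * 2 ^ (2 + s)

multiplier≡1+4r : ∀ s a → ∃ λ r → multiplier s a ≡ 1 + 4 * r
multiplier≡1+4r zero    a = 0 , refl
multiplier≡1+4r (suc s) a =
  let r , h≡1+4r = multiplier≡1+4r s (a / 2)
  in  r + a % 2 * 2 ^ s , trans (cong (_+ a % 2 * 2 ^ (2 + s)) h≡1+4r) (arith r (a % 2) (2 ^ s))
  where
  arith : ∀ r b p → 1 + 4 * r + b * (2 * (2 * p)) ≡ 1 + 4 * (r + b * p)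
  arith = solve-∀

multiplier-invertible : ∀ s a → ∃ λ w → multiplier s a * w ≡ 1 mod 2 ^ (2 + s)
multiplier-invertible s a =
  let r , h≡1+4r = multiplier≡1+4r s a
      w , hw≡1   = odd-invertible (1 + s) (2 * r)
  in  w , subst (λ h → h * w ≡ 1 mod 2 ^ (2 + s)) (sym (trans h≡1+4r (cong (1 +_) (*-assoc 2 2 r)))) hw≡1

multiplier-injective : ∀ s {a a′} → a < 2 ^ s → a′ < 2 ^ s →
                       multiplier s a ≡ multiplier s a′ mod 2 ^ (2 + s) → a ≡ a′
multiplier-injective zero    a<1 a′<1 _ = trans (n<1⇒n≡0 a<1) (sym (n<1⇒n≡0 a′<1))
multiplier-injective (suc s) {a} {a′} a< a′< h≈h′ = %2-/2-injective b≡b′ q≡q′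
  where
  N = 2 ^ (2 + s)
  instance _ = m^n≢0 2 (2 + s)
  h = multiplier s

  q≡q′ : a / 2 ≡ a′ / 2
  q≡q′ = multiplier-injective s (a<2^[1+s]⇒a/2<2^s {s = s} a<) (a<2^[1+s]⇒a/2<2^s {s = s} a′<) (begin
    h (a / 2)                ≈⟨ multiple-mod (h (a / 2)) (a % 2) ⟨
    h (a / 2) + a % 2 * N    ≈⟨ mod-∣ (divides 2 refl) h≈h′ ⟩
    h (a′ / 2) + a′ % 2 * N  ≈⟨ multiple-mod (h (a′ / 2)) (a′ % 2) ⟩
    h (a′ / 2)               ∎)
    where open mod-Reasoning N

  bN≈b′N : a % 2 * N ≡ a′ % 2 * N mod 2 * N
  bN≈b′N = +-cancelˡ-mod (h (a / 2))
             (subst (λ q → h (a / 2) + a % 2 * N ≡ h q + a′ % 2 * N mod 2 * N) (sym q≡q′) h≈h′)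

  b≡b′ : a % 2 ≡ a′ % 2
  b≡b′ = mod-< (m%n<n a 2) (m%n<n a′ 2) (*-cancelˡ-mod N
           (subst₂ (λ x y → x ≡ y mod N * 2) (*-comm (a % 2) N) (*-comm (a′ % 2) N)
             (subst (λ M → a % 2 * N ≡ a′ % 2 * N mod M) (*-comm 2 N) bN≈b′N)))

multipliers-not-opposite : ∀ s a a′ → ¬ (multiplier s a + multiplier s a′ ≡ 0 mod 2 ^ (2 + s))
multipliers-not-opposite s a a′ sum≈0 = contradiction (mod-< (s≤s (s≤s (s≤s z≤n))) (s≤s z≤n) (begin
  2                           ≈⟨ multiple-mod 2 (r + r′) ⟨
  2 + (r + r′) * 4            ≡⟨ arith r r′ ⟩
  (1 + 4 * r) + (1 + 4 * r′)  ≡⟨ cong₂ _+_ h≡1+4r h′≡1+4r′ ⟨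
  multiplier s a + multiplier s a′  ≈⟨ mod-∣ (divides (2 ^ s) (arith′ (2 ^ s))) sum≈0 ⟩
  0                           ∎)) λ ()
  where
  open mod-Reasoning 4
  r  = proj₁ (multiplier≡1+4r s a)
  r′ = proj₁ (multiplier≡1+4r s a′)
  h≡1+4r  = proj₂ (multiplier≡1+4r s a)
  h′≡1+4r′ = proj₂ (multiplier≡1+4r s a′)
  arith : ∀ r r′ → 2 + (r + r′) * 4 ≡ (1 + 4 * r) + (1 + 4 * r′)
  arith = solve-∀
  arith′ : ∀ p → 2 * (2 * p) ≡ p * 4
  arith′ = solve-∀


DifferBy : ℕ → ℕ → ℕ → ℕ → Set
DifferBy m h u v = v ≡ u + h mod m ⊎ u ≡ v + h mod m

differBy-∣ : ∀ {d m h u v} → d ∣ m → DifferBy m h u v → DifferBy d h u v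
differBy-∣ d∣m (inj₁ v≈u+h) = inj₁ (mod-∣ d∣m v≈u+h)
differBy-∣ d∣m (inj₂ u≈v+h) = inj₂ (mod-∣ d∣m u≈v+h)

module _ {m : ℕ} where

  CycleEdge-successor : ∀ {x y} → CycleEdge m x y → y ≡ suc x mod m ⊎ x ≡ suc y mod m
  CycleEdge-successor (inj₁ refl)                      = inj₁ mod-refl
  CycleEdge-successor (inj₂ (inj₁ refl))               = inj₂ mod-refl
  CycleEdge-successor (inj₂ (inj₂ (inj₁ (refl , e)))) = inj₂ (1 , 0 , cong (_+ 0) (sym e))
  CycleEdge-successor (inj₂ (inj₂ (inj₂ (refl , e)))) = inj₁ (1 , 0 , cong (_+ 0) (sym e))

  successor-step : ∀ {a h x y u v} → u ≡ a + h * x mod m → v ≡ a + h * y mod m → y ≡ suc x mod m →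
                   v ≡ u + h mod m
  successor-step {a} {h} {x} {y} {u} {v} u≈ v≈ y≈1+x = begin
    v                ≈⟨ v≈ ⟩
    a + h * y        ≈⟨ +-cong-mod (mod-refl {x = a}) (*-congˡ-mod h y≈1+x) ⟩
    a + h * suc x    ≡⟨ arith a h x ⟩
    (a + h * x) + h  ≈⟨ +-cong-mod (mod-sym u≈) (mod-refl {x = h}) ⟩
    u + h            ∎
    where
    open mod-Reasoning m
    arith : ∀ a h x → a + h * suc x ≡ (a + h * x) + h
    arith = solve-∀

  CycleEdge-differBy : ∀ {a h x y u v} → CycleEdge m x y → u ≡ a + h * x mod m → v ≡ a + h * y mod m →
                       DifferBy m h u v
  CycleEdge-differBy xy u≈ v≈ with CycleEdge-successor xy
  ... | inj₁ y≈1+x = inj₁ (successor-step u≈ v≈ y≈1+x)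
  ... | inj₂ x≈1+y = inj₂ (successor-step v≈ u≈ x≈1+y)

  opposite-steps : ∀ {h h′ u v} → v ≡ u + h mod m → u ≡ v + h′ mod m → h + h′ ≡ 0 mod m
  opposite-steps {h} {h′} {u} {v} v≈u+h u≈v+h′ = mod-sym (+-cancelˡ-mod v (begin
    v + 0         ≡⟨ +-identityʳ v ⟩
    v             ≈⟨ v≈u+h ⟩
    u + h         ≈⟨ +-cong-mod u≈v+h′ (mod-refl {x = h}) ⟩
    v + h′ + h    ≡⟨ arith v h h′ ⟩
    v + (h + h′)  ∎))
    where
    open mod-Reasoning m
    arith : ∀ v h h′ → v + h′ + h ≡ v + (h + h′)
    arith = solve-∀

  differBy-unique : ∀ {h h′ u v} → DifferBy m h u v → DifferBy m h′ u v → h ≡ h′ mod m ⊎ h + h′ ≡ 0 mod m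
  differBy-unique {u = u} (inj₁ v≈u+h) (inj₁ v≈u+h′) = inj₁ (+-cancelˡ-mod u (mod-trans (mod-sym v≈u+h) v≈u+h′))
  differBy-unique {v = v} (inj₂ u≈v+h) (inj₂ u≈v+h′) = inj₁ (+-cancelˡ-mod v (mod-trans (mod-sym u≈v+h) u≈v+h′))
  differBy-unique (inj₁ v≈u+h) (inj₂ u≈v+h′) = inj₂ (opposite-steps v≈u+h u≈v+h′)
  differBy-unique (inj₂ u≈v+h) (inj₁ v≈u+h′) = inj₂ (opposite-steps u≈v+h v≈u+h′)

no-odd-self-step : ∀ {r x} → ¬ (x ≡ x + (1 + 2 * r) mod 2)
no-odd-self-step {r} {x} x≈x+h = 0≢1-mod-2 (mod-trans (+-cancelˡ-mod x x+0≈x+h) (b+2x≡b-mod-2 1 r))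
  where
  x+0≈x+h : x + 0 ≡ x + (1 + 2 * r) mod 2
  x+0≈x+h = subst (_≡ x + (1 + 2 * r) mod 2) (sym (+-identityʳ x)) x≈x+h

odd-step-changes-parity : ∀ {r u v} → DifferBy 2 (1 + 2 * r) u v → ¬ (u ≡ v mod 2)
odd-step-changes-parity {r} (inj₁ v≈u+h) u≈v = no-odd-self-step {r} (mod-trans u≈v v≈u+h)
odd-step-changes-parity {r} (inj₂ u≈v+h) u≈v = no-odd-self-step {r} (mod-trans (mod-sym u≈v) u≈v+h)


affine : ℕ → ℕ → ℕ → ℕ
affine s a x = a + multiplier s a * x

AffineEdge : ℕ → ℕ → ℕ → ℕ → Set
AffineEdge s a u v = ∃₂ λ x y → Triangulation (1 + s) x y ×
                                u ≡ affine s a x mod 2 ^ (2 + s) × v ≡ affine s a y mod 2 ^ (2 + s)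

affine-double : ∀ s a k → affine (suc s) a (2 * k) ≡ a % 2 + 2 * affine s (a / 2) k mod 2 ^ (3 + s)
affine-double s a k = 0 , a % 2 * k , expand (m≡m%2+2*[m/2] a)
  where
  N = 2 ^ (2 + s)
  h = multiplier s (a / 2)
  expand : a ≡ a % 2 + 2 * (a / 2) →
           a + (h + a % 2 * N) * (2 * k) + 0 ≡ a % 2 + 2 * (a / 2 + h * k) + a % 2 * k * (2 * N)
  expand a≡ = trans (cong (λ a′ → a′ + (h + a % 2 * N) * (2 * k) + 0) a≡) (arith (a % 2) (a / 2) h k N)
    where
    arith : ∀ b q h k N → b + 2 * q + (h + b * N) * (2 * k) + 0 ≡ b + 2 * (q + h * k) + b * k * (2 * N)
    arith = solve-∀

lifted-vertex : ∀ s a {k u} → u ≡ affine (suc s) a (2 * k) mod 2 ^ (3 + s) →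
                (u % 2 ≡ a % 2) × u / 2 ≡ affine s (a / 2) k mod 2 ^ (2 + s)
lifted-vertex s a {k} {u} u≈ = halve-mod (m%n<n u 2) (m%n<n a 2)
  (mod-trans (mod-reflexive (sym (m≡m%2+2*[m/2] u))) (mod-trans u≈ (affine-double s a k)))

AffineEdge-lifted : ∀ s a {x y u v} → Lift (Triangulation (1 + s)) x y →
                    u ≡ affine (suc s) a x mod 2 ^ (3 + s) → v ≡ affine (suc s) a y mod 2 ^ (3 + s) →
                    (u % 2 ≡ a % 2) × (v % 2 ≡ a % 2) × AffineEdge s (a / 2) (u / 2) (v / 2)
AffineEdge-lifted s a (k , j , refl , refl , kj) u≈ v≈ =
  let u-parity , u/2≈ = lifted-vertex s a u≈
      v-parity , v/2≈ = lifted-vertex s a v≈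
  in  u-parity , v-parity , k , j , kj , u/2≈ , v/2≈

multiplier-step-changes-parity : ∀ s a {u v} → DifferBy (2 ^ (3 + s)) (multiplier (suc s) a) u v → ¬ u ≡ v mod 2
multiplier-step-changes-parity s a {u} {v} step =
  let r , h≡1+4r = multiplier≡1+4r (suc s) a
  in  odd-step-changes-parity {2 * r}
        (subst (λ h → DifferBy 2 h u v) (trans h≡1+4r (cong (1 +_) (*-assoc 2 2 r)))
               (differBy-∣ (divides (2 ^ (2 + s)) (*-comm 2 (2 ^ (2 + s)))) step))

AffineEdge-offset-unique : ∀ s {a a′ u v} → a < 2 ^ s → a′ < 2 ^ s →
                           AffineEdge s a u v → AffineEdge s a′ u v → a ≡ a′
AffineEdge-offset-unique zero a<1 a′<1 _ _ = trans (n<1⇒n≡0 a<1) (sym (n<1⇒n≡0 a′<1))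
AffineEdge-offset-unique (suc s) {a} {a′} {u} {v} a< a′< (_ , _ , xy , u≈ , v≈) (_ , _ , x′y′ , u≈′ , v≈′) =
  compare xy x′y′ u≈ v≈ u≈′ v≈′
  where
  M = 2 ^ (3 + s)

  compare : ∀ {x y x′ y′} → Triangulation (2 + s) x y → Triangulation (2 + s) x′ y′ →
            u ≡ affine (suc s) a x mod M → v ≡ affine (suc s) a y mod M →
            u ≡ affine (suc s) a′ x′ mod M → v ≡ affine (suc s) a′ y′ mod M → a ≡ a′
  compare (inj₁ xy) (inj₁ x′y′) u≈ v≈ u≈′ v≈′ =
    let u-parity  , _ , edge  = AffineEdge-lifted s a xy u≈ v≈
        u-parity′ , _ , edge′ = AffineEdge-lifted s a′ x′y′ u≈′ v≈′
    in  %2-/2-injective (trans (sym u-parity) u-parity′)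
          (AffineEdge-offset-unique s (a<2^[1+s]⇒a/2<2^s {s = s} a<) (a<2^[1+s]⇒a/2<2^s {s = s} a′<) edge edge′)
  compare (inj₁ xy) (inj₂ x′y′) u≈ v≈ u≈′ v≈′ =
    let u-parity , v-parity , _ = AffineEdge-lifted s a xy u≈ v≈
    in  ⊥-elim (multiplier-step-changes-parity s a′ (CycleEdge-differBy x′y′ u≈′ v≈′)
                                                (%≡⇒mod (trans u-parity (sym v-parity))))
  compare (inj₂ xy) (inj₁ x′y′) u≈ v≈ u≈′ v≈′ =
    let u-parity , v-parity , _ = AffineEdge-lifted s a′ x′y′ u≈′ v≈′
    in  ⊥-elim (multiplier-step-changes-parity s a (CycleEdge-differBy xy u≈ v≈)
                                                (%≡⇒mod (trans u-parity (sym v-parity))))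
  compare (inj₂ xy) (inj₂ x′y′) u≈ v≈ u≈′ v≈′ =
    [ multiplier-injective (suc s) a< a′< , ⊥-elim ∘ multipliers-not-opposite (suc s) a a′ ]′
      (differBy-unique (CycleEdge-differBy xy u≈ v≈) (CycleEdge-differBy x′y′ u≈′ v≈′))

module _ (s : ℕ) where

  private
    instance
      2^[2+s]≢0 : NonZero (2 ^ (2 + s))
      2^[2+s]≢0 = m^n≢0 2 (2 + s)

  familyPermutation : Fin (2 ^ s) → Permutation′ (2 ^ (2 + s))
  familyPermutation i = affinePermutation (toℕ i) (multiplier s (toℕ i)) (proj₁ (multiplier-invertible s (toℕ i)))
    (<⇒≤ (<-≤-trans (Fin.toℕ<n i) (^-monoʳ-≤ 2 (m≤n+m s 2)))) (proj₂ (multiplier-invertible s (toℕ i)))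

  family : Fin (2 ^ s) → Graph (2 ^ (2 + s))
  family i = relabel (familyPermutation i) (triangulation (1 + s))

  family-affineEdge : ∀ i {u v} → adj (family i) u v ≡ true → AffineEdge s (toℕ i) (toℕ u) (toℕ v)
  family-affineEdge i {u} {v} uv =
    toℕ (σ ⟨$⟩ʳ u) , toℕ (σ ⟨$⟩ʳ v) , does⇒ (triangulation? (1 + s) _ _) uv , position u , position v
    where
    σ = familyPermutation i
    position : ∀ w → toℕ w ≡ affine s (toℕ i) (toℕ (σ ⟨$⟩ʳ w)) mod 2 ^ (2 + s)
    position w = subst (λ z → toℕ z ≡ affine s (toℕ i) (toℕ (σ ⟨$⟩ʳ w)) mod 2 ^ (2 + s)) (inverseˡ σ)
                       (toℕ-reduce (affine s (toℕ i) (toℕ (σ ⟨$⟩ʳ w))))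

  family-edgeDisjoint : EdgeDisjoint family
  family-edgeDisjoint i j i≢j u v uv∈i with adj (family j) u v in uv∈j
  ... | false = refl
  ... | true  = contradiction (Fin.toℕ-injective (AffineEdge-offset-unique s (Fin.toℕ<n i) (Fin.toℕ<n j)
                  (family-affineEdge i uv∈i) (family-affineEdge j uv∈j))) i≢j

  family-maximal : ∀ i → MaximalOuterplanar (family i)
  family-maximal i = extremal⇒maximal (2≤2^[1+t] (1 + s)) (family i)
    (relabel-outerplanar σ (triangulation (1 + s)) (triangulation-nonCrossing (1 + s)))
    (trans (cong (_+ 6) (degreeSum-relabel σ (triangulation (1 + s)))) (degreeAt-sum (1 + s)))
    where σ = familyPermutation i

  family-maxDegree : ∀ i → MaxDegree (family i) (2 * s + 3)
  family-maxDegree i = bounded , σ ⟨$⟩ˡ origin , attained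
    where
    σ = familyPermutation i
    origin : Fin (2 ^ (2 + s))
    origin = Fin.fromℕ< (m^n>0 2 (2 + s))
    1+2[1+s]≡2s+3 : 1 + 2 * (1 + s) ≡ 2 * s + 3
    1+2[1+s]≡2s+3 = arith s
      where
      arith : ∀ s → 1 + 2 * (1 + s) ≡ 2 * s + 3
      arith = solve-∀
    bounded : ∀ v → degree (family i) v ≤ 2 * s + 3
    bounded v = begin
      degree (family i) v                ≡⟨ degree-relabel σ (triangulation (1 + s)) v ⟩
      degreeAt (1 + s) (toℕ (σ ⟨$⟩ʳ v))  ≤⟨ degreeAt-bound (1 + s) (Fin.toℕ<n (σ ⟨$⟩ʳ v)) ⟩
      1 + 2 * (1 + s)                    ≡⟨ 1+2[1+s]≡2s+3 ⟩
      2 * s + 3                          ∎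
      where open ≤-Reasoning
    attained : degree (family i) (σ ⟨$⟩ˡ origin) ≡ 2 * s + 3
    attained = begin
      degree (family i) (σ ⟨$⟩ˡ origin)                ≡⟨ degree-relabel σ (triangulation (1 + s)) (σ ⟨$⟩ˡ origin) ⟩
      degreeAt (1 + s) (toℕ (σ ⟨$⟩ʳ (σ ⟨$⟩ˡ origin)))  ≡⟨ cong (degreeAt (1 + s) ∘ toℕ) (inverseʳ σ) ⟩
      degreeAt (1 + s) (toℕ origin)                    ≡⟨ cong (degreeAt (1 + s)) (Fin.toℕ-fromℕ< (m^n>0 2 (2 + s))) ⟩
      degreeAt (1 + s) 0                               ≡⟨ degreeAt-zero (1 + s) ⟩
      1 + 2 * (1 + s)                                  ≡⟨ 1+2[1+s]≡2s+3 ⟩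
      2 * s + 3                                        ∎
      where open ≡-Reasoning

lemma2 : ∀ (s : ℕ) →
    ∃ λ (Gs : Fin (2 ^ s) → Graph (4 * 2 ^ s)) →
      EdgeDisjoint Gs ×
      (∀ i → MaximalOuterplanar (Gs i) × MaxDegree (Gs i) (2 * s + 3))
lemma2 s = subst (λ n → ∃ λ (Gs : Fin (2 ^ s) → Graph n) →
                          EdgeDisjoint Gs × (∀ i → MaximalOuterplanar (Gs i) × MaxDegree (Gs i) (2 * s + 3)))
                 (2^[2+s]≡4*2^s s)
                 (family s , family-edgeDisjoint s , λ i → family-maximal s i , family-maxDegree s i)
  where
  2^[2+s]≡4*2^s : ∀ s → 2 ^ (2 + s) ≡ 4 * 2 ^ s
  2^[2+s]≡4*2^s s = arith (2 ^ s)
    where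
    arith : ∀ p → 2 * (2 * p) ≡ 4 * p
    arith = solve-∀
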